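{- Let $F_i$ denote the Fibonacci numbers ($F_1=F_2=1$, $F_i=F_{i-1}+F_{i-2}$ for $i\ge 3$). Let $k\ge 3$ and let $(a_k,a_{k-1},\dots,a_1)\in\{ -1,0,1\}^k$ satisfy $\sum_{i=1}^k a_iF_i=0$. Then $(a_k,a_{k-1})\notin\{(1,0),(1,1),(-1,0),(-1,-1)\}$ and $(a_k,a_{k-1},a_{k-2})\notin\{(1,-1,1),(-1,1,-1)\}$.
   Context: In the paper's terminology, such a sequence is a representation of $0$ of length $k$ using digits $\{1,0,T\}$ with $T=-1$, and it "starts with" $(b_1,\dots,b_r)$ if $a_{k-i+1}=b_i$ for $1\le i\le r$. -}

module Defs where

open import Data.Nat using (ℕ; zero; suc)
open import Data.Integer using (ℤ; +_; -_; _+_; _*_; 0ℤ; 1ℤ)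

F : ℕ → ℕ
F zero = zero
F (suc zero) = suc zero
F (suc (suc n)) = F (suc n) Data.Nat.+ F n

data Digit : Set where
  T O I : Digit

val : Digit → ℤ
val T = - 1ℤ
val O = 0ℤ
val I = 1ℤ

-- fibSum a k = Σ_{i=1}^{k} a_i F_i   (a is indexed from 1; a 0 is unused)
fibSum : (ℕ → Digit) → ℕ → ℤ
fibSum a zero = 0ℤ
fibSum a (suc n) = val (a (suc n)) * + F (suc n) + fibSum a n

-- Since F 1 + ⋯ + F n = F (n + 2) − 1, every digit sum of length n lies strictly
-- above −F (n + 2). A leading 1 followed by 0 or 1 therefore outweighs the rest:
-- F k + (sum of length k − 2) > F k − F k = 0. For the prefix 1, T, 1 the leading part
-- is F k − F (k − 1) + F (k − 2) = 2 F (k − 2) ≥ F (k − 1), while the rest exceeds −F (k − 1).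
-- The prefixes starting with T follow by negating every digit.
module Submission where

open import Defs
open import Data.Nat using (ℕ; _≤_; _∸_; zero; suc; s≤s; z≤n)
open import Data.Nat.Properties using (m≤m+n)
open import Data.Integer using (ℤ; 0ℤ; 1ℤ; -1ℤ; +_; -_; _+_; _-_; _*_; _<_; -<+; +≤+)
  renaming (_≤_ to _≤ℤ_)
open import Data.Integer.Properties
  using ( ≤-refl; ≤-reflexive; ≤-trans; <-irrefl; neg-≤-pos; i≤j⇒0≤j-i
        ; +-identityˡ; +-inverseʳ; +-comm; +-monoʳ-<; +-mono-≤-<
        ; neg-distrib-+; neg-distribˡ-*; *-identityˡ; -1*i≡-i; module ≤-Reasoning)
open import Data.Integer.Solver using (module +-*-Solver)
open import Data.Product using (_×_; _,_)
open import Data.Sum using (_⊎_; inj₁; inj₂)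
open import Function using (_∘_)
open import Relation.Binary.PropositionalEquality
  using (_≡_; refl; sym; trans; cong; cong₂; subst; module ≡-Reasoning)
open import Relation.Nullary using (¬_)

F-mono : ∀ n → F n ≤ F (suc n)
F-mono zero = z≤n
F-mono (suc zero) = s≤s z≤n
F-mono (suc (suc n)) = m≤m+n _ _

-n≤val*n : ∀ d n → - + n ≤ℤ val d * + n
-n≤val*n T n = ≤-reflexive (sym (-1*i≡-i (+ n)))
-n≤val*n O n = neg-≤-pos
-n≤val*n I n = ≤-trans neg-≤-pos (≤-reflexive (sym (*-identityˡ (+ n))))

0≤val*n : ∀ {d} → d ≡ O ⊎ d ≡ I → ∀ n → 0ℤ ≤ℤ val d * + n
0≤val*n (inj₁ refl) n = ≤-refl
0≤val*n (inj₂ refl) n = subst (0ℤ ≤ℤ_) (sym (*-identityˡ (+ n))) (+≤+ z≤n)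

-F[2+n]<fibSum : ∀ a n → - + F (suc (suc n)) < fibSum a n
-F[2+n]<fibSum a zero = -<+
-F[2+n]<fibSum a (suc n) = begin-strict
  - (+ F (suc (suc n)) + + F (suc n))        ≡⟨ neg-distrib-+ (+ F (suc (suc n))) (+ F (suc n)) ⟩
  - + F (suc (suc n)) + - + F (suc n)        ≡⟨ +-comm (- + F (suc (suc n))) (- + F (suc n)) ⟩
  - + F (suc n) + - + F (suc (suc n))        <⟨ +-mono-≤-< (-n≤val*n (a (suc n)) (F (suc n))) (-F[2+n]<fibSum a n) ⟩
  val (a (suc n)) * + F (suc n) + fibSum a n ∎
  where open ≤-Reasoning

0<fibSum-I[O⊎I] : ∀ a m → a (suc (suc m)) ≡ I → a (suc m) ≡ O ⊎ a (suc m) ≡ I →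
  0ℤ < fibSum a (suc (suc m))
0<fibSum-I[O⊎I] a m aI next rewrite aI = begin-strict
  0ℤ                                    ≡⟨ sym (+-inverseʳ F₂) ⟩
  F₂ - F₂                               ≡⟨ cong (_+_ F₂) (sym (+-identityˡ (- F₂))) ⟩
  F₂ + (0ℤ - F₂)                        <⟨ +-monoʳ-< F₂ (+-mono-≤-< (0≤val*n next (F (suc m))) (-F[2+n]<fibSum a m)) ⟩
  F₂ + tail                             ≡⟨ cong (_+ tail) (sym (*-identityˡ F₂)) ⟩
  1ℤ * F₂ + tail                        ∎
  where
  open ≤-Reasoning
  F₂ tail : ℤ
  F₂ = + F (suc (suc m))
  tail = fibSum a (suc m)

0<fibSum-ITI : ∀ a m → a (suc (suc (suc m))) ≡ I → a (suc (suc m)) ≡ T → a (suc m) ≡ I →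
  0ℤ < fibSum a (suc (suc (suc m)))
0<fibSum-ITI a m a₃ a₂ a₁ rewrite a₃ | a₂ | a₁ = begin-strict
  0ℤ
    ≤⟨ i≤j⇒0≤j-i (+≤+ (F-mono m)) ⟩
  F₁ - F₀
    ≡⟨ leading-part F₁ F₀ ⟩
  1ℤ * F₃ + (-1ℤ * F₂ + (1ℤ * F₁ - F₂))
    <⟨ +-monoʳ-< (1ℤ * F₃) (+-monoʳ-< (-1ℤ * F₂) (+-monoʳ-< (1ℤ * F₁) (-F[2+n]<fibSum a m))) ⟩
  1ℤ * F₃ + (-1ℤ * F₂ + (1ℤ * F₁ + fibSum a m)) ∎
  where
  open ≤-Reasoning
  F₀ F₁ F₂ F₃ : ℤ
  F₀ = + F m
  F₁ = + F (suc m)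
  -- F₂ and F₃ are definitionally + F (2 + m) and + F (3 + m); written this way the
  -- solver below only has to treat F₁ and F₀ as atoms.
  F₂ = F₁ + F₀
  F₃ = F₂ + F₁
  leading-part : ∀ x₁ x₀ →
    x₁ - x₀ ≡ 1ℤ * ((x₁ + x₀) + x₁) + (-1ℤ * (x₁ + x₀) + (1ℤ * x₁ - (x₁ + x₀)))
  leading-part = solve 2 (λ x₁ x₀ →
    x₁ :- x₀ := con 1ℤ :* ((x₁ :+ x₀) :+ x₁) :+ (con -1ℤ :* (x₁ :+ x₀) :+ (con 1ℤ :* x₁ :- (x₁ :+ x₀))))
    refl
    where open +-*-Solver

negDigit : Digit → Digit
negDigit T = I
negDigit O = O
negDigit I = T

val-negDigit : ∀ d → val (negDigit d) ≡ - val d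
val-negDigit T = refl
val-negDigit O = refl
val-negDigit I = refl

fibSum-negDigit : ∀ a n → fibSum (negDigit ∘ a) n ≡ - fibSum a n
fibSum-negDigit a zero = refl
fibSum-negDigit a (suc n) = begin
  val (negDigit (a (suc n))) * Fₙ + fibSum (negDigit ∘ a) n
    ≡⟨ cong₂ (λ v s → v * Fₙ + s) (val-negDigit (a (suc n))) (fibSum-negDigit a n) ⟩
  - val (a (suc n)) * Fₙ + - fibSum a n
    ≡⟨ cong (_+ - fibSum a n) (sym (neg-distribˡ-* (val (a (suc n))) Fₙ)) ⟩
  - (val (a (suc n)) * Fₙ) + - fibSum a n
    ≡⟨ sym (neg-distrib-+ (val (a (suc n)) * Fₙ) (fibSum a n)) ⟩
  - (val (a (suc n)) * Fₙ + fibSum a n) ∎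
  where
  open ≡-Reasoning
  Fₙ = + F (suc n)

theorem2p1 : (k : ℕ) → 3 ≤ k → (a : ℕ → Digit) → fibSum a k ≡ 0ℤ →
    (¬ ((a k ≡ I × a (k ∸ 1) ≡ O) ⊎ (a k ≡ I × a (k ∸ 1) ≡ I)
        ⊎ (a k ≡ T × a (k ∸ 1) ≡ O) ⊎ (a k ≡ T × a (k ∸ 1) ≡ T)))
    × (¬ ((a k ≡ I × a (k ∸ 1) ≡ T × a (k ∸ 2) ≡ I)
        ⊎ (a k ≡ T × a (k ∸ 1) ≡ I × a (k ∸ 2) ≡ T)))
theorem2p1 (suc (suc (suc m))) (s≤s (s≤s (s≤s _))) a sum≡0 =
  (λ { (inj₁ (p , q))               → ≯0 sum≡0 (0<fibSum-I[O⊎I] a (suc m) p (inj₁ q))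
     ; (inj₂ (inj₁ (p , q)))        → ≯0 sum≡0 (0<fibSum-I[O⊎I] a (suc m) p (inj₂ q))
     ; (inj₂ (inj₂ (inj₁ (p , q)))) → ≯0 -sum≡0 (0<fibSum-I[O⊎I] -a (suc m) (cong negDigit p) (inj₁ (cong negDigit q)))
     ; (inj₂ (inj₂ (inj₂ (p , q)))) → ≯0 -sum≡0 (0<fibSum-I[O⊎I] -a (suc m) (cong negDigit p) (inj₂ (cong negDigit q))) }) ,
  (λ { (inj₁ (p , q , r)) → ≯0 sum≡0 (0<fibSum-ITI a m p q r)
     ; (inj₂ (p , q , r)) → ≯0 -sum≡0 (0<fibSum-ITI -a m (cong negDigit p) (cong negDigit q) (cong negDigit r)) })
  where
  -a : ℕ → Digit
  -a = negDigit ∘ a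
  -sum≡0 : fibSum -a (suc (suc (suc m))) ≡ 0ℤ
  -sum≡0 = trans (fibSum-negDigit a _) (cong -_ sum≡0)
  ≯0 : ∀ {x} → x ≡ 0ℤ → ¬ (0ℤ < x)
  ≯0 x≡0 = <-irrefl (sym x≡0)
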